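{- Let $p$ be a prime, let $P_0=\{(t,t^2): t\in\mathbb{F}_p\}\subset\mathbb{F}_p^2$, let $g$ be an invertible affine map $\mathbb{F}_p^2\to\mathbb{F}_p^2$ chosen uniformly at random from the group of all invertible affine maps of $\mathbb{F}_p^2$, and set $P=g(P_0)$. Then for any distinct vectors $v_1,v_2,v_3,v_4\in\mathbb{F}_p^2$, $$\Pr[\{v_1,v_2,v_3\}\subset P]\le p^{ -3}\quad\text{and}\quad \Pr[\{v_1,v_2,v_3,v_4\}\subset P]\le 4p^{ -4}.$$ -}

module Defs where

open import Data.Nat using (ℕ; zero; suc; _+_; _*_; _∸_; NonZero)
open import Data.Nat.DivMod using (_%_; m%n<n)
open import Data.Fin using (Fin; toℕ; fromℕ<)
open import Data.Fin.Properties using (any?)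
import Data.Fin as Fin
open import Data.Product using (_×_; _,_; ∃; Σ)
open import Data.Product.Properties using (≡-dec)
import Data.List
open import Data.List using (List; []; _∷_; concatMap; map; filter; length)
open import Data.List.Relation.Unary.All using (All; all?)
open import Relation.Binary.PropositionalEquality using (_≡_; _≢_)
open import Relation.Nullary using (Dec; ¬?)
open import Relation.Nullary.Decidable using (map′)
import Data.Nat as ℕ



module Fp (p : ℕ) (nz : NonZero p) where
  private instance
    nzI : NonZero p
    nzI = nz

  F : Set
  F = Fin p

  fromN : ℕ → F
  fromN n = fromℕ< (m%n<n n p)

  infixl 6 _+F_ _-F_
  infixl 7 _*F_

  _+F_ : F → F → F
  x +F y = fromN (toℕ x + toℕ y)

  _*F_ : F → F → F
  x *F y = fromN (toℕ x * toℕ y)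

  negF : F → F
  negF x = fromN (p ∸ toℕ x)

  _-F_ : F → F → F
  x -F y = x +F negF y

  elems : List F
  elems = Data.List.allFin p

  Point : Set
  Point = F × F

  _≟P_ : (u v : Point) → Dec (u ≡ v)
  _≟P_ = ≡-dec Fin._≟_ Fin._≟_

  record Aff : Set where
    constructor aff
    field
      a b c d e f : F

  apply : Aff → Point → Point
  apply (aff a b c d e f) (x , y) = (a *F x +F b *F y +F e , c *F x +F d *F y +F f)

  det : Aff → F
  det (aff a b c d e f) = a *F d -F b *F c

  Invertible : Aff → Set
  Invertible g = toℕ (det g) ≢ 0

  invertible? : (g : Aff) → Dec (Invertible g)
  invertible? g = ¬? (toℕ (det g) ℕ.≟ 0)

  InImage : Aff → Point → Set
  InImage g v = ∃ λ (t : F) → apply g (t , t *F t) ≡ v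

  inImage? : (g : Aff) (v : Point) → Dec (InImage g v)
  inImage? g v = any? (λ t → apply g (t , t *F t) ≟P v)

  allAff : List Aff
  allAff = concatMap (λ a → concatMap (λ b → concatMap (λ c → concatMap (λ d →
             concatMap (λ e → map (λ f → aff a b c d e f) elems) elems) elems) elems) elems) elems

  AGL : List Aff
  AGL = filter invertible? allAff

  countContaining : List Point → ℕ
  countContaining vs = length (filter (λ g → all? (inImage? g) vs) AGL)

{-# OPTIONS --safe #-}
-- Each coordinate of t ↦ g(t, t²) is a quadratic polynomial in t, so an affine map g is
-- determined by the parameters t₁, t₂, t₃ of three points vᵢ = g(tᵢ, tᵢ²) of g(P₀): at most
-- p(p − 1)² maps put three given points on their parabola, while |AGL| ≥ p⁴(p − 1)².
-- For a fourth point v₄ = g(t₄, t₄²), the affine coordinates of v₄ with respect to v₁, v₂, v₃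
-- are preserved by g; eliminating t₄ leaves a quadratic equation for t₃ whose coefficients
-- depend only on the vᵢ and t₂ − t₁, and which is nonzero when p ≠ 2 and v₄ ∉ {v₁, v₂, v₃}.
-- So each pair (t₁, t₂) admits at most two t₃, and at most 2p(p − 1) maps fit four points.
module Submission where

open import Defs
open import Level using (Level)
open import Data.Bool.Base using (if_then_else_)
open import Data.Nat.Base using (ℕ; zero; suc; _+_; _*_; _∸_; _^_; _≤_; _<_; z≤n; s≤s; NonZero; >-nonZero⁻¹; nonTrivial⇒n>1)
open import Data.Nat.Properties
  using (≤-refl; ≤-reflexive; ≤-trans; <⇒≤; <⇒≱; +-mono-≤; *-monoˡ-≤; *-monoʳ-≤; m≤m+n; m≤n+m; _≤?_; ≰⇒>; n<1⇒n≡0;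
         +-comm; *-comm; +-assoc; *-assoc; *-distribˡ-+; +-identityʳ; *-identityˡ; m+[n∸m]≡n; m∸n+n≡m; +-suc;
         <-≤-connex; 0≢1+n; ≤∧≢⇒<; +-commutativeSemigroup; module ≤-Reasoning)
import Data.Nat.Properties as ℕ
open import Data.Nat.DivMod using (_%_; m%n<n; %-distribˡ-+; %-distribˡ-*; m<n⇒m%n≡m; n%n≡0)
open import Data.Nat.Divisibility using (_∣_; m%n≡0⇒n∣m; n∣m⇒m%n≡0)
open import Data.Nat.Primality using (Prime; prime⇒nonZero; prime⇒nonTrivial; euclidsLemma)
import Data.Nat.Tactic.RingSolver as ℕ-Solver
open import Data.Integer.Base as ℤ using (ℤ; -[1+_]; _⊖_)
import Data.Integer.Properties as ℤ
open import Data.Fin.Base using (Fin; zero; suc; toℕ)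
open import Data.Fin.Properties using (_≟_; suc-injective; toℕ-injective; toℕ-fromℕ<; toℕ<n)
open import Data.Product.Base using (_×_; _,_; proj₁; proj₂; ∃)
open import Data.Sum.Base as Sum using (_⊎_; inj₁; inj₂; [_,_]′)
open import Data.List.Base using (List; []; _∷_; _++_; length; map; concatMap; filter; tabulate; allFin)
open import Data.Maybe.Base using (Maybe; just; nothing)
open import Data.Empty using (⊥; ⊥-elim)
open import Function.Base using (_∘_; id)
open import Relation.Nullary using (Dec; yes; no; ¬_; does)
open import Relation.Nullary.Decidable using (_×-dec_; map′)
open import Relation.Unary using (Pred; Decidable)
open import Relation.Binary.PropositionalEquality
open import Algebra.Bundles using (CommutativeRing)
open import Algebra.Structures using (IsCommutativeRing)
import Algebra.Consequences.Propositional as Consequences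
open import Algebra.Properties.CommutativeSemigroup +-commutativeSemigroup using (interchange)
import Algebra.Properties.Ring as RingProperties
import Algebra.Properties.AbelianGroup as AbelianGroupProperties
open import Algebra.Solver.Ring.AlmostCommutativeRing using (fromCommutativeRing; _-Raw-AlmostCommutative⟶_)

private
  variable
    a ℓ : Level
    A B : Set a
    P : Set ℓ

𝟙 : Dec P → ℕ
𝟙 P? = if does P? then 1 else 0

𝟙-yes : (P? : Dec P) → P → 𝟙 P? ≡ 1
𝟙-yes (yes _) _  = refl
𝟙-yes (no ¬p) p = ⊥-elim (¬p p)

𝟙-no : (P? : Dec P) → ¬ P → 𝟙 P? ≡ 0
𝟙-no (yes p) ¬p = ⊥-elim (¬p p)
𝟙-no (no _)  _  = refl

𝟙-witness : (P? : Dec P) → 1 ≤ 𝟙 P? → P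
𝟙-witness (yes p) _ = p

δ : ∀ {n} → Fin n → Fin n → ℕ
δ i j = 𝟙 (i ≟ j)

δ-refl : ∀ {n} (i : Fin n) → δ i i ≡ 1
δ-refl i = 𝟙-yes (i ≟ i) refl

∑ : (n : ℕ) → (Fin n → ℕ) → ℕ
∑ zero    h = 0
∑ (suc n) h = h zero + ∑ n (h ∘ suc)

infix 5 ∑
syntax ∑ n (λ i → e) = ∑[ i < n ] e

∑-cong : ∀ n {g h : Fin n → ℕ} → (∀ i → g i ≡ h i) → ∑ n g ≡ ∑ n h
∑-cong zero    eq = refl
∑-cong (suc n) eq = cong₂ _+_ (eq zero) (∑-cong n (eq ∘ suc))

∑-mono : ∀ n {g h : Fin n → ℕ} → (∀ i → g i ≤ h i) → ∑ n g ≤ ∑ n h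
∑-mono zero    le = z≤n
∑-mono (suc n) le = +-mono-≤ (le zero) (∑-mono n (le ∘ suc))

∑-zero : ∀ n {h : Fin n → ℕ} → (∀ i → h i ≡ 0) → ∑ n h ≡ 0
∑-zero zero    eq = refl
∑-zero (suc n) eq = cong₂ _+_ (eq zero) (∑-zero n (eq ∘ suc))

∑-const : ∀ n k → ∑[ i < n ] k ≡ n * k
∑-const zero    k = refl
∑-const (suc n) k = cong (k +_) (∑-const n k)

∑-distrib-+ : ∀ n (g h : Fin n → ℕ) → ∑[ i < n ] (g i + h i) ≡ ∑ n g + ∑ n h
∑-distrib-+ zero    g h = refl
∑-distrib-+ (suc n) g h = trans (cong (g zero + h zero +_) (∑-distrib-+ n (g ∘ suc) (h ∘ suc)))
                               (interchange (g zero) (h zero) _ _)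

∑-δ : ∀ {n} (i₀ : Fin n) (k : Fin n → ℕ) → ∑[ i < n ] δ i i₀ * k i ≡ k i₀
∑-δ {suc n} zero     k = trans (cong₂ _+_ (*-identityˡ (k zero)) (∑-zero n (λ _ → refl))) (+-identityʳ (k zero))
∑-δ {suc n} (suc i₀) k = ∑-δ i₀ (k ∘ suc)

term≤∑ : ∀ n (h : Fin n → ℕ) i → h i ≤ ∑ n h
term≤∑ (suc n) h zero    = m≤m+n (h zero) _
term≤∑ (suc n) h (suc i) = ≤-trans (term≤∑ n (h ∘ suc) i) (m≤n+m _ (h zero))

∑≤* : ∀ n {h : Fin n → ℕ} {m} → (∀ i → h i ≤ m) → ∑ n h ≤ n * m
∑≤* n {m = m} le = ≤-trans (∑-mono n le) (≤-reflexive (∑-const n m))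

*≤∑ : ∀ n {h : Fin n → ℕ} {m} → (∀ i → m ≤ h i) → n * m ≤ ∑ n h
*≤∑ n {m = m} le = ≤-trans (≤-reflexive (sym (∑-const n m))) (∑-mono n le)

∑≤∸1* : ∀ n {h : Fin n → ℕ} {m} (i₀ : Fin n) → h i₀ ≡ 0 → (∀ i → i ≢ i₀ → h i ≤ m) → ∑ n h ≤ (n ∸ 1) * m
∑≤∸1* (suc n)       {h} zero     h₀≡0 le = ≤-trans (≤-reflexive (cong (_+ ∑ n (h ∘ suc)) h₀≡0)) (∑≤* n (λ i → le (suc i) λ ()))
∑≤∸1* (suc (suc n))     (suc i₀) h₀≡0 le =
  +-mono-≤ (le zero λ ()) (∑≤∸1* (suc n) i₀ h₀≡0 (λ i i≢i₀ → le (suc i) (i≢i₀ ∘ suc-injective)))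

∸1*≤∑ : ∀ n {h : Fin n → ℕ} {m} → (∀ i j → h i < m → h j < m → i ≡ j) → (n ∸ 1) * m ≤ ∑ n h
∸1*≤∑ zero    small-unique = z≤n
∸1*≤∑ (suc n) {h} {m} small-unique with m ≤? h zero
... | yes m≤h₀ = ≤-trans (k*m≤m+[k∸1]*m n) (+-mono-≤ m≤h₀ (∸1*≤∑ n (λ i j hi<m hj<m → suc-injective (small-unique _ _ hi<m hj<m))))
  where
  k*m≤m+[k∸1]*m : ∀ k → k * m ≤ m + (k ∸ 1) * m
  k*m≤m+[k∸1]*m zero    = z≤n
  k*m≤m+[k∸1]*m (suc k) = ≤-refl
... | no  m≰h₀ = ≤-trans (*≤∑ n large) (m≤n+m _ (h zero))
  where
  large : ∀ i → m ≤ h (suc i)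
  large i with m ≤? h (suc i)
  ... | yes m≤hᵢ = m≤hᵢ
  ... | no  m≰hᵢ with () ← small-unique zero (suc i) (≰⇒> m≰h₀) (≰⇒> m≰hᵢ)

∑≤1 : ∀ n {h : Fin n → ℕ} → (∀ i → h i ≤ 1) → (∀ i j → 1 ≤ h i → 1 ≤ h j → i ≡ j) → ∑ n h ≤ 1
∑≤1 zero    ≤1 unique = z≤n
∑≤1 (suc n) {h} ≤1 unique with 1 ≤? h zero
... | yes 1≤h₀ = ≤-trans (+-mono-≤ (≤1 zero) (≤-reflexive (∑-zero n rest≡0))) (s≤s z≤n)
  where
  rest≡0 : ∀ i → h (suc i) ≡ 0
  rest≡0 i with 1 ≤? h (suc i)
  ... | yes 1≤hᵢ with () ← unique zero (suc i) 1≤h₀ 1≤hᵢ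
  ... | no  1≰hᵢ = n<1⇒n≡0 (≰⇒> 1≰hᵢ)
... | no 1≰h₀ = subst (λ h₀ → h₀ + ∑ n (h ∘ suc) ≤ 1) (sym (n<1⇒n≡0 (≰⇒> 1≰h₀)))
                  (∑≤1 n (≤1 ∘ suc) (λ i j 1≤hᵢ 1≤hⱼ → suc-injective (unique _ _ 1≤hᵢ 1≤hⱼ)))

∑≤2 : ∀ n {h : Fin n → ℕ} → (∀ i → h i ≤ 1) →
      (∀ i j k → 1 ≤ h i → 1 ≤ h j → 1 ≤ h k → i ≢ j → i ≢ k → j ≢ k → ⊥) → ∑ n h ≤ 2
∑≤2 zero    ≤1 no-three = z≤n
∑≤2 (suc n) {h} ≤1 no-three with 1 ≤? h zero
... | yes 1≤h₀ = +-mono-≤ (≤1 zero) (∑≤1 n (≤1 ∘ suc) unique)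
  where
  unique : ∀ i j → 1 ≤ h (suc i) → 1 ≤ h (suc j) → i ≡ j
  unique i j 1≤hᵢ 1≤hⱼ with i ≟ j
  ... | yes i≡j = i≡j
  ... | no  i≢j = ⊥-elim (no-three zero (suc i) (suc j) 1≤h₀ 1≤hᵢ 1≤hⱼ (λ ()) (λ ()) (i≢j ∘ suc-injective))
... | no 1≰h₀ = subst (λ h₀ → h₀ + ∑ n (h ∘ suc) ≤ 2) (sym (n<1⇒n≡0 (≰⇒> 1≰h₀)))
                  (∑≤2 n (≤1 ∘ suc) (λ i j k 1≤hᵢ 1≤hⱼ 1≤hₖ i≢j i≢k j≢k →
                     no-three _ _ _ 1≤hᵢ 1≤hⱼ 1≤hₖ (i≢j ∘ suc-injective) (i≢k ∘ suc-injective) (j≢k ∘ suc-injective)))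

∑ˡ : List A → (A → ℕ) → ℕ
∑ˡ []       h = 0
∑ˡ (x ∷ xs) h = h x + ∑ˡ xs h

infix 5 ∑ˡ
syntax ∑ˡ xs (λ x → e) = ∑[ x ∈ xs ] e

∑ˡ-mono : ∀ (xs : List A) {g h : A → ℕ} → (∀ x → g x ≤ h x) → ∑ˡ xs g ≤ ∑ˡ xs h
∑ˡ-mono []       le = z≤n
∑ˡ-mono (x ∷ xs) le = +-mono-≤ (le x) (∑ˡ-mono xs le)

∑ˡ-zero : ∀ (xs : List A) {h : A → ℕ} → (∀ x → h x ≡ 0) → ∑ˡ xs h ≡ 0
∑ˡ-zero []       eq = refl
∑ˡ-zero (x ∷ xs) eq = cong₂ _+_ (eq x) (∑ˡ-zero xs eq)

∑ˡ-++ : ∀ (xs ys : List A) h → ∑ˡ (xs ++ ys) h ≡ ∑ˡ xs h + ∑ˡ ys h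
∑ˡ-++ []       ys h = refl
∑ˡ-++ (x ∷ xs) ys h = trans (cong (h x +_) (∑ˡ-++ xs ys h)) (sym (+-assoc (h x) _ _))

∑ˡ-concatMap : ∀ (f : A → List B) xs h → ∑ˡ (concatMap f xs) h ≡ ∑[ x ∈ xs ] ∑ˡ (f x) h
∑ˡ-concatMap f []       h = refl
∑ˡ-concatMap f (x ∷ xs) h = trans (∑ˡ-++ (f x) _ h) (cong (∑ˡ (f x) h +_) (∑ˡ-concatMap f xs h))

∑ˡ-map : ∀ (f : A → B) xs h → ∑ˡ (map f xs) h ≡ ∑ˡ xs (h ∘ f)
∑ˡ-map f []       h = refl
∑ˡ-map f (x ∷ xs) h = cong (h (f x) +_) (∑ˡ-map f xs h)

∑ˡ-tabulate : ∀ n (f : Fin n → A) h → ∑ˡ (tabulate f) h ≡ ∑ n (h ∘ f)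
∑ˡ-tabulate zero    f h = refl
∑ˡ-tabulate (suc n) f h = cong (h (f zero) +_) (∑ˡ-tabulate n (f ∘ suc) h)

∑ˡ-allFin : ∀ n h → ∑ˡ (allFin n) h ≡ ∑ n h
∑ˡ-allFin n = ∑ˡ-tabulate n id

∑ˡ-concatMap-allFin : ∀ n (f : Fin n → List A) h → ∑ˡ (concatMap f (allFin n)) h ≡ ∑[ i < n ] ∑ˡ (f i) h
∑ˡ-concatMap-allFin n f h = trans (∑ˡ-concatMap f (allFin n) h) (∑ˡ-allFin n _)

∑ˡ-∑-comm : ∀ (xs : List A) n (h : A → Fin n → ℕ) → ∑[ x ∈ xs ] ∑ n (h x) ≡ ∑[ i < n ] ∑[ x ∈ xs ] h x i
∑ˡ-∑-comm []       n h = sym (∑-zero n (λ _ → refl))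
∑ˡ-∑-comm (x ∷ xs) n h = trans (cong (∑ n (h x) +_) (∑ˡ-∑-comm xs n h)) (sym (∑-distrib-+ n (h x) _))

∑ˡ-witness : ∀ (xs : List A) {h : A → ℕ} → 1 ≤ ∑ˡ xs h → ∃ λ x → 1 ≤ h x
∑ˡ-witness (x ∷ xs) {h} 1≤∑ with 1 ≤? h x
... | yes 1≤hx = x , 1≤hx
... | no  1≰hx = ∑ˡ-witness xs (subst (λ hx → 1 ≤ hx + ∑ˡ xs h) (n<1⇒n≡0 (≰⇒> 1≰hx)) 1≤∑)

preimage-≢ : ∀ (f : A → B) {x y u v} → f x ≡ u → f y ≡ v → u ≢ v → x ≢ y
preimage-≢ f fx≡u fy≡v u≢v x≡y = u≢v (trans (sym fx≡u) (trans (cong f x≡y) fy≡v))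

module _ {P : Pred A ℓ} (P? : Decidable P) where

  ∑ˡ-filter : ∀ xs h → ∑ˡ (filter P? xs) h ≡ ∑[ x ∈ xs ] 𝟙 (P? x) * h x
  ∑ˡ-filter []       h = refl
  ∑ˡ-filter (x ∷ xs) h with P? x
  ... | yes _ = cong₂ _+_ (sym (+-identityʳ (h x))) (∑ˡ-filter xs h)
  ... | no  _ = ∑ˡ-filter xs h

  length-filter≡∑𝟙 : ∀ xs → length (filter P? xs) ≡ ∑[ x ∈ xs ] 𝟙 (P? x)
  length-filter≡∑𝟙 []       = refl
  length-filter≡∑𝟙 (x ∷ xs) with P? x
  ... | yes _ = cong suc (length-filter≡∑𝟙 xs)
  ... | no  _ = length-filter≡∑𝟙 xs

module PrimeField (p : ℕ) (pr : Prime p) where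

  open Fp p (prime⇒nonZero pr) public
  open import Data.Integer.Base public using (+_)

  private instance
    p≢0 : NonZero p
    p≢0 = prime⇒nonZero pr

  0F 1F : F
  0F = fromN 0
  1F = fromN 1

  toℕ-fromN : ∀ n → toℕ (fromN n) ≡ n % p
  toℕ-fromN n = toℕ-fromℕ< (m%n<n n p)

  toℕ-0F : toℕ 0F ≡ 0
  toℕ-0F = trans (toℕ-fromN 0) (m<n⇒m%n≡m (>-nonZero⁻¹ p))

  fromN-cong-% : ∀ {m n} → m % p ≡ n % p → fromN m ≡ fromN n
  fromN-cong-% {m} {n} eq = toℕ-injective (trans (toℕ-fromN m) (trans eq (sym (toℕ-fromN n))))

  fromN-toℕ : ∀ x → fromN (toℕ x) ≡ x
  fromN-toℕ x = toℕ-injective (trans (toℕ-fromN (toℕ x)) (m<n⇒m%n≡m (toℕ<n x)))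

  fromN-+ : ∀ m n → fromN (m + n) ≡ fromN m +F fromN n
  fromN-+ m n = fromN-cong-% (trans (%-distribˡ-+ m n p)
                  (sym (cong₂ (λ u v → (u + v) % p) (toℕ-fromN m) (toℕ-fromN n))))

  fromN-* : ∀ m n → fromN (m * n) ≡ fromN m *F fromN n
  fromN-* m n = fromN-cong-% (trans (%-distribˡ-* m n p)
                  (sym (cong₂ (λ u v → (u * v) % p) (toℕ-fromN m) (toℕ-fromN n))))

  fromN-p : fromN p ≡ 0F
  fromN-p = toℕ-injective (trans (toℕ-fromN p) (trans (n%n≡0 p) (sym toℕ-0F)))

  +F-comm : ∀ x y → x +F y ≡ y +F x
  +F-comm x y = cong fromN (+-comm (toℕ x) (toℕ y))

  *F-comm : ∀ x y → x *F y ≡ y *F x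
  *F-comm x y = cong fromN (*-comm (toℕ x) (toℕ y))

  +F-assoc : ∀ x y z → (x +F y) +F z ≡ x +F (y +F z)
  +F-assoc x y z = begin
    fromN (toℕ x + toℕ y) +F z              ≡⟨ cong (fromN (toℕ x + toℕ y) +F_) (fromN-toℕ z) ⟨
    fromN (toℕ x + toℕ y) +F fromN (toℕ z)  ≡⟨ fromN-+ _ _ ⟨
    fromN (toℕ x + toℕ y + toℕ z)           ≡⟨ cong fromN (+-assoc (toℕ x) _ _) ⟩
    fromN (toℕ x + (toℕ y + toℕ z))         ≡⟨ fromN-+ _ _ ⟩
    fromN (toℕ x) +F (y +F z)               ≡⟨ cong (_+F (y +F z)) (fromN-toℕ x) ⟩
    x +F (y +F z)                           ∎
    where open ≡-Reasoning

  *F-assoc : ∀ x y z → (x *F y) *F z ≡ x *F (y *F z)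
  *F-assoc x y z = begin
    fromN (toℕ x * toℕ y) *F z              ≡⟨ cong (fromN (toℕ x * toℕ y) *F_) (fromN-toℕ z) ⟨
    fromN (toℕ x * toℕ y) *F fromN (toℕ z)  ≡⟨ fromN-* _ _ ⟨
    fromN (toℕ x * toℕ y * toℕ z)           ≡⟨ cong fromN (*-assoc (toℕ x) _ _) ⟩
    fromN (toℕ x * (toℕ y * toℕ z))         ≡⟨ fromN-* _ _ ⟩
    fromN (toℕ x) *F (y *F z)               ≡⟨ cong (_*F (y *F z)) (fromN-toℕ x) ⟩
    x *F (y *F z)                           ∎
    where open ≡-Reasoning

  *F-distribˡ-+F : ∀ x y z → x *F (y +F z) ≡ x *F y +F x *F z
  *F-distribˡ-+F x y z = begin
    x *F fromN (toℕ y + toℕ z)               ≡⟨ cong (_*F fromN (toℕ y + toℕ z)) (fromN-toℕ x) ⟨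
    fromN (toℕ x) *F fromN (toℕ y + toℕ z)   ≡⟨ fromN-* _ _ ⟨
    fromN (toℕ x * (toℕ y + toℕ z))          ≡⟨ cong fromN (*-distribˡ-+ (toℕ x) _ _) ⟩
    fromN (toℕ x * toℕ y + toℕ x * toℕ z)    ≡⟨ fromN-+ _ _ ⟩
    x *F y +F x *F z                         ∎
    where open ≡-Reasoning

  +F-identityˡ : ∀ x → 0F +F x ≡ x
  +F-identityˡ x = begin
    0F +F x              ≡⟨ cong (0F +F_) (fromN-toℕ x) ⟨
    0F +F fromN (toℕ x)  ≡⟨ fromN-+ 0 _ ⟨
    fromN (toℕ x)        ≡⟨ fromN-toℕ x ⟩
    x                    ∎
    where open ≡-Reasoning

  *F-identityˡ : ∀ x → 1F *F x ≡ x
  *F-identityˡ x = begin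
    1F *F x              ≡⟨ cong (1F *F_) (fromN-toℕ x) ⟨
    1F *F fromN (toℕ x)  ≡⟨ fromN-* 1 _ ⟨
    fromN (1 * toℕ x)    ≡⟨ cong fromN (*-identityˡ (toℕ x)) ⟩
    fromN (toℕ x)        ≡⟨ fromN-toℕ x ⟩
    x                    ∎
    where open ≡-Reasoning

  negF-inverseʳ : ∀ x → x +F negF x ≡ 0F
  negF-inverseʳ x = begin
    x +F negF x                      ≡⟨ cong (_+F negF x) (fromN-toℕ x) ⟨
    fromN (toℕ x) +F fromN (p ∸ toℕ x) ≡⟨ fromN-+ _ _ ⟨
    fromN (toℕ x + (p ∸ toℕ x))      ≡⟨ cong fromN (m+[n∸m]≡n (<⇒≤ (toℕ<n x))) ⟩
    fromN p                          ≡⟨ fromN-p ⟩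
    0F                               ∎
    where open ≡-Reasoning

  F-isCommutativeRing : IsCommutativeRing _≡_ _+F_ _*F_ negF 0F 1F
  F-isCommutativeRing = record
    { isRing = record
      { +-isAbelianGroup = record
        { isGroup = record
          { isMonoid = record
            { isSemigroup = record
              { isMagma = record { isEquivalence = isEquivalence ; ∙-cong = cong₂ _+F_ }
              ; assoc = +F-assoc }
            ; identity = comm∧idˡ⇒id +F-comm +F-identityˡ }
          ; inverse = comm∧invʳ⇒inv +F-comm negF-inverseʳ
          ; ⁻¹-cong = cong negF }
        ; comm = +F-comm }
      ; *-cong = cong₂ _*F_
      ; *-assoc = *F-assoc
      ; *-identity = comm∧idˡ⇒id *F-comm *F-identityˡ
      ; distrib = *F-distribˡ-+F , comm∧distrˡ⇒distrʳ *F-comm *F-distribˡ-+F }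
    ; *-comm = *F-comm }
    where open Consequences {A = F}

  F-commutativeRing : CommutativeRing _ _
  F-commutativeRing = record { isCommutativeRing = F-isCommutativeRing }

  open CommutativeRing F-commutativeRing
    using (-‿inverseʳ; ring; +-abelianGroup)
  open RingProperties ring using (-‿distribˡ-*; -‿distribʳ-*; x[y-z]≈xy-xz)
  open AbelianGroupProperties +-abelianGroup
    using (ε⁻¹≈ε; ⁻¹-involutive; ⁻¹-∙-comm; ⁻¹-anti-homo‿-; //-rightDividesʳ; x∙y⁻¹≈ε⇒x≈y)

  fromN-∸ : ∀ {m n} → n ≤ m → fromN (m ∸ n) ≡ fromN m -F fromN n
  fromN-∸ {m} {n} n≤m = begin
    fromN (m ∸ n)                       ≡⟨ //-rightDividesʳ (fromN n) _ ⟨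
    fromN (m ∸ n) +F fromN n -F fromN n  ≡⟨ cong (_-F fromN n) (fromN-+ (m ∸ n) n) ⟨
    fromN (m ∸ n + n) -F fromN n        ≡⟨ cong (λ k → fromN k -F fromN n) (m∸n+n≡m n≤m) ⟩
    fromN m -F fromN n                  ∎
    where open ≡-Reasoning

  -- Ring identities in F are normalised with integer coefficients, mapped into F by ℤ→F:
  -- with p a variable, arithmetic on the constants of F itself does not compute.
  ℤ→F : ℤ → F
  ℤ→F (+ n)    = fromN n
  ℤ→F -[1+ n ] = negF (fromN (suc n))

  ℤ→F-neg : ∀ i → ℤ→F (ℤ.- i) ≡ negF (ℤ→F i)
  ℤ→F-neg (+ zero)  = sym ε⁻¹≈ε
  ℤ→F-neg (+ suc n) = refl
  ℤ→F-neg -[1+ n ]  = sym (⁻¹-involutive _)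

  ℤ→F-⊖ : ∀ m n → ℤ→F (m ⊖ n) ≡ fromN m -F fromN n
  ℤ→F-⊖ m n with <-≤-connex m n
  ... | inj₂ n≤m = trans (cong ℤ→F (ℤ.⊖-≥ n≤m)) (fromN-∸ n≤m)
  ... | inj₁ m<n = begin
    ℤ→F (m ⊖ n)                 ≡⟨ cong ℤ→F (ℤ.⊖-< m<n) ⟩
    ℤ→F (ℤ.- (+ (n ∸ m)))       ≡⟨ ℤ→F-neg (+ (n ∸ m)) ⟩
    negF (fromN (n ∸ m))        ≡⟨ cong negF (fromN-∸ (<⇒≤ m<n)) ⟩
    negF (fromN n -F fromN m)   ≡⟨ ⁻¹-anti-homo‿- (fromN n) (fromN m) ⟩
    fromN m -F fromN n          ∎
    where open ≡-Reasoning

  ℤ→F-+ : ∀ i j → ℤ→F (i ℤ.+ j) ≡ ℤ→F i +F ℤ→F j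
  ℤ→F-+ (+ m)    (+ n)    = fromN-+ m n
  ℤ→F-+ (+ m)    -[1+ n ] = ℤ→F-⊖ m (suc n)
  ℤ→F-+ -[1+ m ] (+ n)    = trans (ℤ→F-⊖ n (suc m)) (+F-comm (fromN n) _)
  ℤ→F-+ -[1+ m ] -[1+ n ] = begin
    negF (fromN (suc (suc (m + n))))           ≡⟨ cong (negF ∘ fromN ∘ suc) (+-suc m n) ⟨
    negF (fromN (suc m + suc n))               ≡⟨ cong negF (fromN-+ (suc m) (suc n)) ⟩
    negF (fromN (suc m) +F fromN (suc n))      ≡⟨ ⁻¹-∙-comm (fromN (suc m)) (fromN (suc n)) ⟨
    negF (fromN (suc m)) +F negF (fromN (suc n)) ∎
    where open ≡-Reasoning

  ℤ→F-*-+ : ∀ m j → ℤ→F (+ m ℤ.* j) ≡ fromN m *F ℤ→F j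
  ℤ→F-*-+ m (+ n)    = trans (cong ℤ→F (sym (ℤ.pos-* m n))) (fromN-* m n)
  ℤ→F-*-+ m -[1+ n ] = begin
    ℤ→F (+ m ℤ.* ℤ.- (+ suc n))        ≡⟨ cong ℤ→F (ℤ.neg-distribʳ-* (+ m) (+ suc n)) ⟨
    ℤ→F (ℤ.- (+ m ℤ.* + suc n))        ≡⟨ ℤ→F-neg (+ m ℤ.* + suc n) ⟩
    negF (ℤ→F (+ m ℤ.* + suc n))       ≡⟨ cong negF (ℤ→F-*-+ m (+ suc n)) ⟩
    negF (fromN m *F fromN (suc n))    ≡⟨ -‿distribʳ-* (fromN m) _ ⟩
    fromN m *F negF (fromN (suc n))    ∎
    where open ≡-Reasoning

  ℤ→F-* : ∀ i j → ℤ→F (i ℤ.* j) ≡ ℤ→F i *F ℤ→F j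
  ℤ→F-* (+ m)    j = ℤ→F-*-+ m j
  ℤ→F-* -[1+ m ] j = begin
    ℤ→F (ℤ.- (+ suc m) ℤ.* j)          ≡⟨ cong ℤ→F (ℤ.neg-distribˡ-* (+ suc m) j) ⟨
    ℤ→F (ℤ.- (+ suc m ℤ.* j))          ≡⟨ ℤ→F-neg (+ suc m ℤ.* j) ⟩
    negF (ℤ→F (+ suc m ℤ.* j))         ≡⟨ cong negF (ℤ→F-*-+ (suc m) j) ⟩
    negF (fromN (suc m) *F ℤ→F j)      ≡⟨ -‿distribˡ-* (fromN (suc m)) _ ⟩
    negF (fromN (suc m)) *F ℤ→F j      ∎
    where open ≡-Reasoning

  ℤ→F-morphism : CommutativeRing.rawRing ℤ.+-*-commutativeRing -Raw-AlmostCommutative⟶ fromCommutativeRing F-commutativeRing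
  ℤ→F-morphism = record
    { ⟦_⟧ = ℤ→F ; +-homo = ℤ→F-+ ; *-homo = ℤ→F-* ; -‿homo = ℤ→F-neg ; 0-homo = refl ; 1-homo = refl }

  ℤ→F-≟ : ∀ i j → Maybe (ℤ→F i ≡ ℤ→F j)
  ℤ→F-≟ i j with i ℤ.≟ j
  ... | yes i≡j = just (cong ℤ→F i≡j)
  ... | no  _   = nothing

  open import Algebra.Solver.Ring _ (fromCommutativeRing F-commutativeRing) ℤ→F-morphism ℤ→F-≟ public
    using (solve; _:=_; con; _:+_; _:*_; _:-_)

  p≥2 : 2 ≤ p
  p≥2 = nonTrivial⇒n>1 p {{prime⇒nonTrivial pr}}

  toℕ≡0⇒≡0F : ∀ {x} → toℕ x ≡ 0 → x ≡ 0F
  toℕ≡0⇒≡0F x≡0 = toℕ-injective (trans x≡0 (sym toℕ-0F))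

  p∣toℕ⇒≡0F : ∀ {x} → p ∣ toℕ x → x ≡ 0F
  p∣toℕ⇒≡0F {x} p∣x = toℕ≡0⇒≡0F (trans (sym (m<n⇒m%n≡m (toℕ<n x))) (n∣m⇒m%n≡0 _ p p∣x))

  *F≡0⇒≡0F : ∀ x y → x *F y ≡ 0F → x ≡ 0F ⊎ y ≡ 0F
  *F≡0⇒≡0F x y xy≡0 = Sum.map p∣toℕ⇒≡0F p∣toℕ⇒≡0F (euclidsLemma (toℕ x) (toℕ y) pr p∣xy)
    where
    p∣xy : p ∣ toℕ x * toℕ y
    p∣xy = m%n≡0⇒n∣m _ p (trans (sym (toℕ-fromN _)) (trans (cong toℕ xy≡0) toℕ-0F))

  *F-≢0 : ∀ {x y} → x ≢ 0F → y ≢ 0F → x *F y ≢ 0F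
  *F-≢0 {x} {y} x≢0 y≢0 xy≡0 = [ x≢0 , y≢0 ]′ (*F≡0⇒≡0F x y xy≡0)

  *F≡0-cancelˡ : ∀ {x y} → x ≢ 0F → x *F y ≡ 0F → y ≡ 0F
  *F≡0-cancelˡ {x} {y} x≢0 xy≡0 = [ ⊥-elim ∘ x≢0 , id ]′ (*F≡0⇒≡0F x y xy≡0)

  *F≡0-cancelʳ : ∀ {x y} → y ≢ 0F → x *F y ≡ 0F → x ≡ 0F
  *F≡0-cancelʳ {x} {y} y≢0 xy≡0 = [ id , ⊥-elim ∘ y≢0 ]′ (*F≡0⇒≡0F x y xy≡0)

  -F≡0⇒≡ : ∀ {x y} → x -F y ≡ 0F → x ≡ y
  -F≡0⇒≡ = x∙y⁻¹≈ε⇒x≈y _ _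

  ≢⇒-F≢0 : ∀ {x y} → x ≢ y → x -F y ≢ 0F
  ≢⇒-F≢0 x≢y = x≢y ∘ -F≡0⇒≡

  -F-cancelʳ : ∀ {x y z} → x -F z ≡ y -F z → x ≡ y
  -F-cancelʳ {x} {y} {z} eq = -F≡0⇒≡ (begin
    x -F y                   ≡⟨ solve 3 (λ x y z → x :- y := (x :- z) :- (y :- z)) refl x y z ⟩
    (x -F z) -F (y -F z)     ≡⟨ cong (_-F (y -F z)) eq ⟩
    (y -F z) -F (y -F z)     ≡⟨ -‿inverseʳ _ ⟩
    0F                       ∎)
    where open ≡-Reasoning

  *F-cancelˡ : ∀ {k x y} → k ≢ 0F → k *F x ≡ k *F y → x ≡ y
  *F-cancelˡ {k} {x} {y} k≢0 eq = -F≡0⇒≡ (*F≡0-cancelˡ k≢0 k[x-y]≡0)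
    where
    k[x-y]≡0 : k *F (x -F y) ≡ 0F
    k[x-y]≡0 = trans (x[y-z]≈xy-xz k x y) (trans (cong (_-F k *F y) eq) (-‿inverseʳ _))

  two : F
  two = 1F +F 1F

  two≢0 : p ≢ 2 → two ≢ 0F
  two≢0 p≢2 two≡0 = 0≢1+n (begin
    0                ≡⟨ toℕ-0F ⟨
    toℕ 0F           ≡⟨ cong toℕ (trans (fromN-+ 1 1) two≡0) ⟨
    toℕ (fromN 2)    ≡⟨ toℕ-fromN 2 ⟩
    2 % p            ≡⟨ m<n⇒m%n≡m (≤∧≢⇒< p≥2 (p≢2 ∘ sym)) ⟩
    2                ∎)
    where open ≡-Reasoning

  quadratic : F → F → F → F → F
  quadratic a b c t = a *F t +F b *F (t *F t) +F c

  quadratic-three-roots : ∀ {a b c r₁ r₂ r₃} → r₁ ≢ r₂ → r₁ ≢ r₃ → r₂ ≢ r₃ →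
    quadratic a b c r₁ ≡ 0F → quadratic a b c r₂ ≡ 0F → quadratic a b c r₃ ≡ 0F →
    a ≡ 0F × b ≡ 0F × c ≡ 0F
  quadratic-three-roots {a} {b} {c} {r₁} {r₂} {r₃} r₁≢r₂ r₁≢r₃ r₂≢r₃ q₁ q₂ q₃ = a≡0 , b≡0 , c≡0
    where
    open ≡-Reasoning
    chord≡0 : ∀ {r s} → r ≢ s → quadratic a b c r ≡ 0F → quadratic a b c s ≡ 0F → a +F b *F (r +F s) ≡ 0F
    chord≡0 {r} {s} r≢s qr qs = *F≡0-cancelˡ (≢⇒-F≢0 r≢s) (begin
      (r -F s) *F (a +F b *F (r +F s))
        ≡⟨ solve 5 (λ a b c r s → (r :- s) :* (a :+ b :* (r :+ s))
                                  := (a :* r :+ b :* (r :* r) :+ c) :- (a :* s :+ b :* (s :* s) :+ c))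
                   refl a b c r s ⟩
      quadratic a b c r -F quadratic a b c s
        ≡⟨ cong₂ _-F_ qr qs ⟩
      0F -F 0F
        ≡⟨ -‿inverseʳ 0F ⟩
      0F ∎)
    chord₁₂ : a +F b *F (r₁ +F r₂) ≡ 0F
    chord₁₂ = chord≡0 r₁≢r₂ q₁ q₂
    b≡0 : b ≡ 0F
    b≡0 = *F≡0-cancelʳ (≢⇒-F≢0 r₂≢r₃) (begin
      b *F (r₂ -F r₃)
        ≡⟨ solve 5 (λ a b r₁ r₂ r₃ → b :* (r₂ :- r₃) := (a :+ b :* (r₁ :+ r₂)) :- (a :+ b :* (r₁ :+ r₃)))
                   refl a b r₁ r₂ r₃ ⟩
      (a +F b *F (r₁ +F r₂)) -F (a +F b *F (r₁ +F r₃))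
        ≡⟨ cong₂ _-F_ chord₁₂ (chord≡0 r₁≢r₃ q₁ q₃) ⟩
      0F -F 0F
        ≡⟨ -‿inverseʳ 0F ⟩
      0F ∎)
    a≡0 : a ≡ 0F
    a≡0 = begin
      a                          ≡⟨ solve 2 (λ a r → a := a :+ con (+ 0) :* r) refl a (r₁ +F r₂) ⟩
      a +F 0F *F (r₁ +F r₂)      ≡⟨ cong (λ b → a +F b *F (r₁ +F r₂)) b≡0 ⟨
      a +F b *F (r₁ +F r₂)       ≡⟨ chord₁₂ ⟩
      0F                         ∎
    c≡0 : c ≡ 0F
    c≡0 = begin
      c                          ≡⟨ solve 2 (λ c r → c := con (+ 0) :* r :+ con (+ 0) :* (r :* r) :+ c) refl c r₁ ⟩
      quadratic 0F 0F c r₁       ≡⟨ cong₂ (λ a b → quadratic a b c r₁) a≡0 b≡0 ⟨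
      quadratic a b c r₁         ≡⟨ q₁ ⟩
      0F                         ∎

  quadratic-difference : ∀ a b c a′ b′ c′ r →
    quadratic (a -F a′) (b -F b′) (c -F c′) r ≡ quadratic a b c r -F quadratic a′ b′ c′ r
  quadratic-difference = solve 7 (λ a b c a′ b′ c′ r →
    (a :- a′) :* r :+ (b :- b′) :* (r :* r) :+ (c :- c′)
    := (a :* r :+ b :* (r :* r) :+ c) :- (a′ :* r :+ b′ :* (r :* r) :+ c′)) refl

  quadratic-unique : ∀ {a b c a′ b′ c′ r₁ r₂ r₃} → r₁ ≢ r₂ → r₁ ≢ r₃ → r₂ ≢ r₃ →
    quadratic a b c r₁ ≡ quadratic a′ b′ c′ r₁ → quadratic a b c r₂ ≡ quadratic a′ b′ c′ r₂ →
    quadratic a b c r₃ ≡ quadratic a′ b′ c′ r₃ → a ≡ a′ × b ≡ b′ × c ≡ c′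
  quadratic-unique {a} {b} {c} {a′} {b′} {c′} r₁≢r₂ r₁≢r₃ r₂≢r₃ eq₁ eq₂ eq₃ =
    let a-a′≡0 , b-b′≡0 , c-c′≡0 = quadratic-three-roots r₁≢r₂ r₁≢r₃ r₂≢r₃ (root eq₁) (root eq₂) (root eq₃)
    in -F≡0⇒≡ a-a′≡0 , -F≡0⇒≡ b-b′≡0 , -F≡0⇒≡ c-c′≡0
    where
    root : ∀ {r} → quadratic a b c r ≡ quadratic a′ b′ c′ r → quadratic (a -F a′) (b -F b′) (c -F c′) r ≡ 0F
    root {r} eq = trans (quadratic-difference a b c a′ b′ c′ r)
                    (trans (cong (_-F quadratic a′ b′ c′ r) eq) (-‿inverseʳ _))

module AffinePlane (p : ℕ) (pr : Prime p) where

  open PrimeField p pr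

  parabola : F → Point
  parabola t = (t , t *F t)

  infix 25 _⟨_⟩
  _⟨_⟩ : Aff → F → Point
  g ⟨ t ⟩ = apply g (parabola t)

  aff-cong : ∀ {a b c d e f a′ b′ c′ d′ e′ f′} → a ≡ a′ → b ≡ b′ → c ≡ c′ → d ≡ d′ → e ≡ e′ → f ≡ f′ →
             aff a b c d e f ≡ aff a′ b′ c′ d′ e′ f′
  aff-cong refl refl refl refl refl refl = refl

  parabola-determines-map : ∀ {g g′ t₁ t₂ t₃} → t₁ ≢ t₂ → t₁ ≢ t₃ → t₂ ≢ t₃ →
    g ⟨ t₁ ⟩ ≡ g′ ⟨ t₁ ⟩ → g ⟨ t₂ ⟩ ≡ g′ ⟨ t₂ ⟩ → g ⟨ t₃ ⟩ ≡ g′ ⟨ t₃ ⟩ → g ≡ g′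
  parabola-determines-map {aff _ _ _ _ _ _} {aff _ _ _ _ _ _} t₁≢t₂ t₁≢t₃ t₂≢t₃ eq₁ eq₂ eq₃ =
    let a≡a′ , b≡b′ , e≡e′ = quadratic-unique t₁≢t₂ t₁≢t₃ t₂≢t₃ (cong proj₁ eq₁) (cong proj₁ eq₂) (cong proj₁ eq₃)
        c≡c′ , d≡d′ , f≡f′ = quadratic-unique t₁≢t₂ t₁≢t₃ t₂≢t₃ (cong proj₂ eq₁) (cong proj₂ eq₂) (cong proj₂ eq₃)
    in aff-cong a≡a′ b≡b′ c≡c′ d≡d′ e≡e′ f≡f′

  infixl 6 _-ᵥ_ _+ᵥ_
  infixl 7 _·ᵥ_

  _-ᵥ_ : Point → Point → Point
  (x , y) -ᵥ (x′ , y′) = (x -F x′ , y -F y′)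

  _+ᵥ_ : Point → Point → Point
  (x , y) +ᵥ (x′ , y′) = (x +F x′ , y +F y′)

  _·ᵥ_ : F → Point → Point
  k ·ᵥ (x , y) = (k *F x , k *F y)

  area : Point → Point → Point → F
  area (x₀ , y₀) (x₁ , y₁) (x₂ , y₂) = (x₁ -F x₀) *F (y₂ -F y₀) -F (y₁ -F y₀) *F (x₂ -F x₀)

  cramer : ∀ v₁ v₂ v₃ v₄ →
    area v₁ v₂ v₃ ·ᵥ (v₄ -ᵥ v₁) ≡ area v₁ v₄ v₃ ·ᵥ (v₂ -ᵥ v₁) +ᵥ area v₁ v₂ v₄ ·ᵥ (v₃ -ᵥ v₁)
  cramer (x₁ , y₁) (x₂ , y₂) (x₃ , y₃) (x₄ , y₄) =
    cong₂ _,_ (solve 8 (λ x₁ y₁ x₂ y₂ x₃ y₃ x₄ y₄ →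
                 ((x₂ :- x₁) :* (y₃ :- y₁) :- (y₂ :- y₁) :* (x₃ :- x₁)) :* (x₄ :- x₁)
                 := ((x₄ :- x₁) :* (y₃ :- y₁) :- (y₄ :- y₁) :* (x₃ :- x₁)) :* (x₂ :- x₁)
                    :+ ((x₂ :- x₁) :* (y₄ :- y₁) :- (y₂ :- y₁) :* (x₄ :- x₁)) :* (x₃ :- x₁))
                refl x₁ y₁ x₂ y₂ x₃ y₃ x₄ y₄)
              (solve 8 (λ x₁ y₁ x₂ y₂ x₃ y₃ x₄ y₄ →
                 ((x₂ :- x₁) :* (y₃ :- y₁) :- (y₂ :- y₁) :* (x₃ :- x₁)) :* (y₄ :- y₁)
                 := ((x₄ :- x₁) :* (y₃ :- y₁) :- (y₄ :- y₁) :* (x₃ :- x₁)) :* (y₂ :- y₁)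
                    :+ ((x₂ :- x₁) :* (y₄ :- y₁) :- (y₂ :- y₁) :* (x₄ :- x₁)) :* (y₃ :- y₁))
                refl x₁ y₁ x₂ y₂ x₃ y₃ x₄ y₄)

  scaled-chord-injective : ∀ {k o u w} → k ≢ 0F → k ·ᵥ (u -ᵥ o) ≡ k ·ᵥ (w -ᵥ o) → u ≡ w
  scaled-chord-injective {o = x , y} {_ , _} {_ , _} k≢0 eq =
    cong₂ _,_ (-F-cancelʳ {z = x} (*F-cancelˡ k≢0 (cong proj₁ eq))) (-F-cancelʳ {z = y} (*F-cancelˡ k≢0 (cong proj₂ eq)))

  Vertex : F → F → F → Set
  Vertex K α β = (α ≡ 0F × β ≡ 0F) ⊎ (α ≡ K × β ≡ 0F) ⊎ (α ≡ 0F × β ≡ K)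

  vertex-from-weights : ∀ {K α β o u w v} → K ≢ 0F → K ·ᵥ (v -ᵥ o) ≡ α ·ᵥ (u -ᵥ o) +ᵥ β ·ᵥ (w -ᵥ o) →
                        Vertex K α β → v ≡ o ⊎ v ≡ u ⊎ v ≡ w
  vertex-from-weights {K} {α} {β} {o} {u} {w} {v} K≢0 eq = Sum.map
    (reweigh o (coordinatewise at-o))
    (Sum.map (reweigh u (coordinatewise at-u)) (reweigh w (coordinatewise at-w)))
    where
    open ≡-Reasoning
    reweigh : ∀ {α′ β′} t → α′ ·ᵥ (u -ᵥ o) +ᵥ β′ ·ᵥ (w -ᵥ o) ≡ K ·ᵥ (t -ᵥ o) → α ≡ α′ × β ≡ β′ → v ≡ t
    reweigh {α′} {β′} t combination (α≡α′ , β≡β′) = scaled-chord-injective {o = o} {v} {t} K≢0 (begin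
      K ·ᵥ (v -ᵥ o)                       ≡⟨ eq ⟩
      α ·ᵥ (u -ᵥ o) +ᵥ β ·ᵥ (w -ᵥ o)       ≡⟨ cong₂ (λ α β → α ·ᵥ (u -ᵥ o) +ᵥ β ·ᵥ (w -ᵥ o)) α≡α′ β≡β′ ⟩
      α′ ·ᵥ (u -ᵥ o) +ᵥ β′ ·ᵥ (w -ᵥ o)     ≡⟨ combination ⟩
      K ·ᵥ (t -ᵥ o)                       ∎)
    coordinatewise : ∀ {f g : F → F → F → F} → (∀ z zᵤ z_w → f z zᵤ z_w ≡ g z zᵤ z_w) →
                     (f (proj₁ o) (proj₁ u) (proj₁ w) , f (proj₂ o) (proj₂ u) (proj₂ w))
                     ≡ (g (proj₁ o) (proj₁ u) (proj₁ w) , g (proj₂ o) (proj₂ u) (proj₂ w))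
    coordinatewise identity = cong₂ _,_ (identity _ _ _) (identity _ _ _)
    at-o : ∀ z zᵤ z_w → 0F *F (zᵤ -F z) +F 0F *F (z_w -F z) ≡ K *F (z -F z)
    at-o = solve 4 (λ k z zᵤ z_w → con (+ 0) :* (zᵤ :- z) :+ con (+ 0) :* (z_w :- z) := k :* (z :- z)) refl K
    at-u : ∀ z zᵤ z_w → K *F (zᵤ -F z) +F 0F *F (z_w -F z) ≡ K *F (zᵤ -F z)
    at-u = solve 4 (λ k z zᵤ z_w → k :* (zᵤ :- z) :+ con (+ 0) :* (z_w :- z) := k :* (zᵤ :- z)) refl K
    at-w : ∀ z zᵤ z_w → 0F *F (zᵤ -F z) +F K *F (z_w -F z) ≡ K *F (z_w -F z)
    at-w = solve 4 (λ k z zᵤ z_w → con (+ 0) :* (zᵤ :- z) :+ k :* (z_w :- z) := k :* (z_w :- z)) refl K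

  -- With K = area v₁ v₂ v₃, α = area v₁ v₄ v₃ and β = area v₁ v₂ v₄, cramer says that λ = α / K and
  -- μ = β / K are the coordinates of v₄ − v₁ in the basis v₂ − v₁, v₃ − v₁, which affine maps preserve.
  -- For points of the parabola, with sᵢ = tᵢ − t₁, this gives s₄ = λ s₂ + μ s₃ and s₄² = λ s₂² + μ s₃²;
  -- eliminating s₄ leaves (α s₂ + β s₃)² = K (α s₂² + β s₃²), which is this quadratic in s₃.
  fourthPointQuadratic : F → F → F → F → F → F
  fourthPointQuadratic K α β s = quadratic (two *F α *F β *F s) (β *F β -F K *F β) ((α *F α -F K *F α) *F (s *F s))

  x²-Kx≡0⇒ : ∀ {K x} → x *F x -F K *F x ≡ 0F → x ≡ 0F ⊎ x ≡ K
  x²-Kx≡0⇒ {K} {x} eq = Sum.map₂ -F≡0⇒≡ (*F≡0⇒≡0F x (x -F K)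
    (trans (solve 2 (λ k x → x :* (x :- k) := x :* x :- k :* x) refl K x) eq))

  vanishing-coefficients⇒vertex : ∀ {K α β s} → two ≢ 0F → s ≢ 0F →
    two *F α *F β *F s ≡ 0F × β *F β -F K *F β ≡ 0F × (α *F α -F K *F α) *F (s *F s) ≡ 0F → Vertex K α β
  vanishing-coefficients⇒vertex {K} {α} {β} {s} two≢0 s≢0 (linear≡0 , quadratic≡0 , constant≡0) =
    [ (λ α≡0 → Sum.map (α≡0 ,_) (λ β≡K → inj₂ (α≡0 , β≡K)) (x²-Kx≡0⇒ quadratic≡0))
    , (λ β≡0 → Sum.map (_, β≡0) (λ α≡K → inj₁ (α≡K , β≡0)) (x²-Kx≡0⇒ (*F≡0-cancelʳ (*F-≢0 s≢0 s≢0) constant≡0)))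
    ]′ (Sum.map₁ (*F≡0-cancelˡ two≢0) (*F≡0⇒≡0F (two *F α) β (*F≡0-cancelʳ s≢0 linear≡0)))

  area-on-parabola : ∀ g t₁ tᵢ tⱼ → area (g ⟨ t₁ ⟩) (g ⟨ tᵢ ⟩) (g ⟨ tⱼ ⟩)
                     ≡ det g *F (tᵢ -F t₁) *F (tⱼ -F t₁) *F ((tⱼ -F t₁) -F (tᵢ -F t₁))
  area-on-parabola (aff a b c d e f) = solve 9 (λ a b c d e f t₁ tᵢ tⱼ →
    let x = λ t → a :* t :+ b :* (t :* t) :+ e
        y = λ t → c :* t :+ d :* (t :* t) :+ f
    in (x tᵢ :- x t₁) :* (y tⱼ :- y t₁) :- (y tᵢ :- y t₁) :* (x tⱼ :- x t₁)
       := (a :* d :- b :* c) :* (tᵢ :- t₁) :* (tⱼ :- t₁) :* ((tⱼ :- t₁) :- (tᵢ :- t₁))) refl a b c d e f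

  fourth-point-elimination : ∀ D s₂ s₃ s₄ →
    fourthPointQuadratic (D *F s₂ *F s₃ *F (s₃ -F s₂)) (D *F s₄ *F s₃ *F (s₃ -F s₄)) (D *F s₂ *F s₄ *F (s₄ -F s₂)) s₂ s₃ ≡ 0F
  fourth-point-elimination = solve 4 (λ D s₂ s₃ s₄ →
    let K = D :* s₂ :* s₃ :* (s₃ :- s₂)
        α = D :* s₄ :* s₃ :* (s₃ :- s₄)
        β = D :* s₂ :* s₄ :* (s₄ :- s₂)
    in ((con (+ 1) :+ con (+ 1)) :* α :* β :* s₂) :* s₃ :+ (β :* β :- K :* β) :* (s₃ :* s₃) :+ (α :* α :- K :* α) :* (s₂ :* s₂)
       := con (+ 0)) refl

  parabola-four-points : ∀ {g v₁ v₂ v₃ v₄} t₁ t₂ t₃ t₄ →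
    g ⟨ t₁ ⟩ ≡ v₁ → g ⟨ t₂ ⟩ ≡ v₂ → g ⟨ t₃ ⟩ ≡ v₃ → g ⟨ t₄ ⟩ ≡ v₄ →
    fourthPointQuadratic (area v₁ v₂ v₃) (area v₁ v₄ v₃) (area v₁ v₂ v₄) (t₂ -F t₁) (t₃ -F t₁) ≡ 0F
  parabola-four-points {g} t₁ t₂ t₃ t₄ e₁ e₂ e₃ e₄ =
    subst₂ (λ (v₁ , v₂) (v₃ , v₄) → fourthPointQuadratic (area v₁ v₂ v₃) (area v₁ v₄ v₃) (area v₁ v₂ v₄) s₂ s₃ ≡ 0F)
      (cong₂ _,_ e₁ e₂) (cong₂ _,_ e₃ e₄)
      (at-areas (area-on-parabola g t₁ t₂ t₃) (area-on-parabola g t₁ t₄ t₃) (area-on-parabola g t₁ t₂ t₄))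
    where
    s₂ s₃ s₄ : F
    s₂ = t₂ -F t₁
    s₃ = t₃ -F t₁
    s₄ = t₄ -F t₁
    at-areas : ∀ {K α β} → K ≡ det g *F s₂ *F s₃ *F (s₃ -F s₂) → α ≡ det g *F s₄ *F s₃ *F (s₃ -F s₄) →
               β ≡ det g *F s₂ *F s₄ *F (s₄ -F s₂) → fourthPointQuadratic K α β s₂ s₃ ≡ 0F
    at-areas refl refl refl = fourth-point-elimination (det g) s₂ s₃ s₄

  invertible⇒det≢0 : ∀ {g} → Invertible g → det g ≢ 0F
  invertible⇒det≢0 inv det≡0 = inv (trans (cong toℕ det≡0) toℕ-0F)

  ¬invertible⇒det≡0 : ∀ {g} → ¬ Invertible g → det g ≡ 0F
  ¬invertible⇒det≡0 {g} ¬inv with toℕ (det g) ℕ.≟ 0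
  ... | yes det≡0 = toℕ≡0⇒≡0F det≡0
  ... | no  det≢0 = ⊥-elim (¬inv det≢0)

module Counting (p : ℕ) (pr : Prime p) where

  open PrimeField p pr
  open AffinePlane p pr
  open import Data.List.Relation.Unary.All using (All; []; _∷_; all?)

  -- Factors are listed innermost coordinate first, so that ∑-δ peels off the nested sums of ∑-allAff.
  δᴬ : Aff → Aff → ℕ
  δᴬ (aff a b c d e f) (aff a₀ b₀ c₀ d₀ e₀ f₀) = δ f f₀ * (δ e e₀ * (δ d d₀ * (δ c c₀ * (δ b b₀ * (δ a a₀ * 1)))))

  δᴬ-refl : ∀ g → δᴬ g g ≡ 1
  δᴬ-refl (aff a b c d e f) rewrite δ-refl a | δ-refl b | δ-refl c | δ-refl d | δ-refl e | δ-refl f = refl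

  ∑-allAff : ∀ h → ∑[ g ∈ allAff ] h g
                   ≡ ∑[ a < p ] ∑[ b < p ] ∑[ c < p ] ∑[ d < p ] ∑[ e < p ] ∑[ f < p ] h (aff a b c d e f)
  ∑-allAff h =
    trans (∑ˡ-concatMap-allFin p _ h) (∑-cong p λ a →
    trans (∑ˡ-concatMap-allFin p _ h) (∑-cong p λ b →
    trans (∑ˡ-concatMap-allFin p _ h) (∑-cong p λ c →
    trans (∑ˡ-concatMap-allFin p _ h) (∑-cong p λ d →
    trans (∑ˡ-concatMap-allFin p _ h) (∑-cong p λ e →
    trans (∑ˡ-map _ elems h) (∑ˡ-allFin p _))))))

  ∑-allAff-δᴬ : ∀ g₀ → ∑[ g ∈ allAff ] δᴬ g g₀ ≡ 1
  ∑-allAff-δᴬ (aff a₀ b₀ c₀ d₀ e₀ f₀) =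
    trans (∑-allAff _) (
    trans (∑-cong p λ a → ∑-cong p λ b → ∑-cong p λ c → ∑-cong p λ d → ∑-cong p λ e → ∑-δ f₀ _) (
    trans (∑-cong p λ a → ∑-cong p λ b → ∑-cong p λ c → ∑-cong p λ d → ∑-δ e₀ _) (
    trans (∑-cong p λ a → ∑-cong p λ b → ∑-cong p λ c → ∑-δ d₀ _) (
    trans (∑-cong p λ a → ∑-cong p λ b → ∑-δ c₀ _) (
    trans (∑-cong p λ a → ∑-δ b₀ _) (
    ∑-δ a₀ _))))))

  ∑-allAff-𝟙≤1 : ∀ {ℓ} {P : Aff → Set ℓ} (P? : ∀ g → Dec (P g)) → (∀ g g′ → P g → P g′ → g ≡ g′) →
                 ∑[ g ∈ allAff ] 𝟙 (P? g) ≤ 1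
  ∑-allAff-𝟙≤1 {P = P} P? unique with 1 ≤? ∑[ g ∈ allAff ] 𝟙 (P? g)
  ... | no  1≰∑ = <⇒≤ (≰⇒> 1≰∑)
  ... | yes 1≤∑ = ≤-trans (∑ˡ-mono allAff 𝟙≤δᴬ) (≤-reflexive (∑-allAff-δᴬ g₀))
    where
    g₀ : Aff
    g₀ = proj₁ (∑ˡ-witness allAff 1≤∑)
    Pg₀ : P g₀
    Pg₀ = 𝟙-witness (P? g₀) (proj₂ (∑ˡ-witness allAff 1≤∑))
    𝟙≤δᴬ : ∀ g → 𝟙 (P? g) ≤ δᴬ g g₀
    𝟙≤δᴬ g with P? g
    ... | yes Pg = ≤-reflexive (sym (trans (cong (λ g → δᴬ g g₀) (unique g g₀ Pg Pg₀)) (δᴬ-refl g₀)))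
    ... | no  _  = z≤n

  record Fits (v₁ v₂ v₃ : Point) (vs : List Point) (g : Aff) (t₁ t₂ t₃ : F) : Set where
    constructor fits
    field
      invertible : Invertible g
      maps-t₁    : g ⟨ t₁ ⟩ ≡ v₁
      maps-t₂    : g ⟨ t₂ ⟩ ≡ v₂
      maps-t₃    : g ⟨ t₃ ⟩ ≡ v₃
      contains   : All (InImage g) vs

  fits? : ∀ v₁ v₂ v₃ vs g t₁ t₂ t₃ → Dec (Fits v₁ v₂ v₃ vs g t₁ t₂ t₃)
  fits? v₁ v₂ v₃ vs g t₁ t₂ t₃ =
    map′ (λ (inv , e₁ , e₂ , e₃ , on) → fits inv e₁ e₂ e₃ on) (λ (fits inv e₁ e₂ e₃ on) → inv , e₁ , e₂ , e₃ , on)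
      (invertible? g ×-dec g ⟨ t₁ ⟩ ≟P v₁ ×-dec g ⟨ t₂ ⟩ ≟P v₂ ×-dec g ⟨ t₃ ⟩ ≟P v₃ ×-dec all? (inImage? g) vs)

  #fits : Point → Point → Point → List Point → F → F → F → ℕ
  #fits v₁ v₂ v₃ vs t₁ t₂ t₃ = ∑[ g ∈ allAff ] 𝟙 (fits? v₁ v₂ v₃ vs g t₁ t₂ t₃)

  module _ (v₁ v₂ v₃ : Point) (vs : List Point) where

    countContaining≤∑#fits :
      countContaining (v₁ ∷ v₂ ∷ v₃ ∷ vs) ≤ ∑[ t₁ < p ] ∑[ t₂ < p ] ∑[ t₃ < p ] #fits v₁ v₂ v₃ vs t₁ t₂ t₃
    countContaining≤∑#fits = begin
      countContaining (v₁ ∷ v₂ ∷ v₃ ∷ vs)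
        ≡⟨ length-filter≡∑𝟙 (λ g → all? (inImage? g) _) AGL ⟩
      ∑[ g ∈ AGL ] 𝟙 (all? (inImage? g) (v₁ ∷ v₂ ∷ v₃ ∷ vs))
        ≡⟨ ∑ˡ-filter invertible? allAff _ ⟩
      ∑[ g ∈ allAff ] 𝟙 (invertible? g) * 𝟙 (all? (inImage? g) (v₁ ∷ v₂ ∷ v₃ ∷ vs))
        ≤⟨ ∑ˡ-mono allAff (λ g → fits-somewhere g (invertible? g) (all? (inImage? g) _)) ⟩
      ∑[ g ∈ allAff ] ∑[ t₁ < p ] ∑[ t₂ < p ] ∑[ t₃ < p ] 𝟙 (fits? v₁ v₂ v₃ vs g t₁ t₂ t₃)
        ≡⟨ trans (∑ˡ-∑-comm allAff p _) (∑-cong p λ t₁ →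
           trans (∑ˡ-∑-comm allAff p _) (∑-cong p λ t₂ → ∑ˡ-∑-comm allAff p _)) ⟩
      ∑[ t₁ < p ] ∑[ t₂ < p ] ∑[ t₃ < p ] #fits v₁ v₂ v₃ vs t₁ t₂ t₃
        ∎
      where
      open ≤-Reasoning
      fits-somewhere : ∀ g (inv? : Dec (Invertible g)) (on? : Dec (All (InImage g) (v₁ ∷ v₂ ∷ v₃ ∷ vs))) →
        𝟙 inv? * 𝟙 on? ≤ ∑[ t₁ < p ] ∑[ t₂ < p ] ∑[ t₃ < p ] 𝟙 (fits? v₁ v₂ v₃ vs g t₁ t₂ t₃)
      fits-somewhere g (yes inv) (yes ((t₁ , e₁) ∷ (t₂ , e₂) ∷ (t₃ , e₃) ∷ on)) =
        ≤-trans (≤-reflexive (sym (𝟙-yes (fits? v₁ v₂ v₃ vs g t₁ t₂ t₃) (fits inv e₁ e₂ e₃ on))))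
        (≤-trans (term≤∑ p (λ t → 𝟙 (fits? v₁ v₂ v₃ vs g t₁ t₂ t)) t₃)
        (≤-trans (term≤∑ p (λ t → ∑[ t₃ < p ] 𝟙 (fits? v₁ v₂ v₃ vs g t₁ t t₃)) t₂)
                 (term≤∑ p (λ t → ∑[ t₂ < p ] ∑[ t₃ < p ] 𝟙 (fits? v₁ v₂ v₃ vs g t t₂ t₃)) t₁)))
      fits-somewhere g (yes _) (no _) = z≤n
      fits-somewhere g (no _)  _      = z≤n

    #fits≡0 : ∀ {t₁ t₂ t₃} → (∀ g → ¬ Fits v₁ v₂ v₃ vs g t₁ t₂ t₃) → #fits v₁ v₂ v₃ vs t₁ t₂ t₃ ≡ 0
    #fits≡0 {t₁} {t₂} {t₃} nowhere = ∑ˡ-zero allAff (λ g → 𝟙-no (fits? v₁ v₂ v₃ vs g t₁ t₂ t₃) (nowhere g))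

    #fits-witness : ∀ {t₁ t₂ t₃} → 1 ≤ #fits v₁ v₂ v₃ vs t₁ t₂ t₃ → ∃ λ g → Fits v₁ v₂ v₃ vs g t₁ t₂ t₃
    #fits-witness {t₁} {t₂} {t₃} 1≤#fits =
      let g , 1≤𝟙 = ∑ˡ-witness allAff 1≤#fits in g , 𝟙-witness (fits? v₁ v₂ v₃ vs g t₁ t₂ t₃) 1≤𝟙

    #fits≤1 : v₁ ≢ v₂ → v₁ ≢ v₃ → v₂ ≢ v₃ → ∀ t₁ t₂ t₃ → #fits v₁ v₂ v₃ vs t₁ t₂ t₃ ≤ 1
    #fits≤1 v₁≢v₂ v₁≢v₃ v₂≢v₃ t₁ t₂ t₃ = ∑-allAff-𝟙≤1 (λ g → fits? v₁ v₂ v₃ vs g t₁ t₂ t₃) unique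
      where
      unique : ∀ g g′ → Fits v₁ v₂ v₃ vs g t₁ t₂ t₃ → Fits v₁ v₂ v₃ vs g′ t₁ t₂ t₃ → g ≡ g′
      unique g g′ (fits _ e₁ e₂ e₃ _) (fits _ e₁′ e₂′ e₃′ _) =
        parabola-determines-map (preimage-≢ (g ⟨_⟩) e₁ e₂ v₁≢v₂) (preimage-≢ (g ⟨_⟩) e₁ e₃ v₁≢v₃) (preimage-≢ (g ⟨_⟩) e₂ e₃ v₂≢v₃)
          (trans e₁ (sym e₁′)) (trans e₂ (sym e₂′)) (trans e₃ (sym e₃′))

  countContaining-three : ∀ {v₁ v₂ v₃} → v₁ ≢ v₂ → v₁ ≢ v₃ → v₂ ≢ v₃ →
                          countContaining (v₁ ∷ v₂ ∷ v₃ ∷ []) ≤ p * ((p ∸ 1) * ((p ∸ 1) * 1))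
  countContaining-three {v₁} {v₂} {v₃} v₁≢v₂ v₁≢v₃ v₂≢v₃ = ≤-trans (countContaining≤∑#fits v₁ v₂ v₃ [])
    (∑≤* p λ t₁ → ∑≤∸1* p t₁ (∑-zero p λ _ → #fits≡0 v₁ v₂ v₃ [] λ { g (fits _ e₁ e₂ _ _) → v₁≢v₂ (trans (sym e₁) e₂) })
      λ t₂ _ → ∑≤∸1* p t₁ (#fits≡0 v₁ v₂ v₃ [] λ { g (fits _ e₁ _ e₃ _) → v₁≢v₃ (trans (sym e₁) e₃) })
        λ t₃ _ → #fits≤1 v₁ v₂ v₃ [] v₁≢v₂ v₁≢v₃ v₂≢v₃ t₁ t₂ t₃)

  fits⇒area≢0 : ∀ {v₁ v₂ v₃ vs g t₁ t₂ t₃} → v₁ ≢ v₂ → v₁ ≢ v₃ → v₂ ≢ v₃ →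
                Fits v₁ v₂ v₃ vs g t₁ t₂ t₃ → area v₁ v₂ v₃ ≢ 0F
  fits⇒area≢0 {g = g} {t₁} {t₂} {t₃} v₁≢v₂ v₁≢v₃ v₂≢v₃ (fits inv refl refl refl _) =
    subst (_≢ 0F) (sym (area-on-parabola g t₁ t₂ t₃))
      (*F-≢0 (*F-≢0 (*F-≢0 (invertible⇒det≢0 {g} inv) (≢⇒-F≢0 (t₁≢t₂ ∘ sym))) (≢⇒-F≢0 (t₁≢t₃ ∘ sym)))
             (≢⇒-F≢0 (t₂≢t₃ ∘ sym ∘ -F-cancelʳ {z = t₁})))
    where
    t₁≢t₂ : t₁ ≢ t₂
    t₁≢t₂ = preimage-≢ (g ⟨_⟩) refl refl v₁≢v₂
    t₁≢t₃ : t₁ ≢ t₃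
    t₁≢t₃ = preimage-≢ (g ⟨_⟩) refl refl v₁≢v₃
    t₂≢t₃ : t₂ ≢ t₃
    t₂≢t₃ = preimage-≢ (g ⟨_⟩) refl refl v₂≢v₃

  fits⇒fourthPointQuadratic≡0 : ∀ {v₁ v₂ v₃ v₄ g t₁ t₂ t₃} → Fits v₁ v₂ v₃ (v₄ ∷ []) g t₁ t₂ t₃ →
    fourthPointQuadratic (area v₁ v₂ v₃) (area v₁ v₄ v₃) (area v₁ v₂ v₄) (t₂ -F t₁) (t₃ -F t₁) ≡ 0F
  fits⇒fourthPointQuadratic≡0 {g = g} {t₁} {t₂} {t₃} (fits _ e₁ e₂ e₃ ((t₄ , e₄) ∷ [])) =
    parabola-four-points {g} t₁ t₂ t₃ t₄ e₁ e₂ e₃ e₄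

  module _ {v₁ v₂ v₃ v₄ : Point} (v₁≢v₂ : v₁ ≢ v₂) (v₁≢v₃ : v₁ ≢ v₃) (v₁≢v₄ : v₁ ≢ v₄)
           (v₂≢v₃ : v₂ ≢ v₃) (v₂≢v₄ : v₂ ≢ v₄) (v₃≢v₄ : v₃ ≢ v₄) where

    private
      #fits₄ : F → F → F → ℕ
      #fits₄ = #fits v₁ v₂ v₃ (v₄ ∷ [])

    no-three-t₃ : p ≢ 2 → ∀ {t₁ t₂} → t₂ ≢ t₁ → ∀ r₁ r₂ r₃ →
      1 ≤ #fits₄ t₁ t₂ r₁ → 1 ≤ #fits₄ t₁ t₂ r₂ → 1 ≤ #fits₄ t₁ t₂ r₃ → r₁ ≢ r₂ → r₁ ≢ r₃ → r₂ ≢ r₃ → ⊥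
    no-three-t₃ p≢2 {t₁} {t₂} t₂≢t₁ r₁ r₂ r₃ fits₁ fits₂ fits₃ r₁≢r₂ r₁≢r₃ r₂≢r₃ =
      [ v₁≢v₄ ∘ sym , [ v₂≢v₄ ∘ sym , v₃≢v₄ ∘ sym ]′ ]′
        (vertex-from-weights K≢0 (cramer v₁ v₂ v₃ v₄)
          (vanishing-coefficients⇒vertex (two≢0 p≢2) (≢⇒-F≢0 t₂≢t₁)
            (quadratic-three-roots (shift r₁≢r₂) (shift r₁≢r₃) (shift r₂≢r₃) (root fits₁) (root fits₂) (root fits₃))))
      where
      K≢0 : area v₁ v₂ v₃ ≢ 0F
      K≢0 = fits⇒area≢0 v₁≢v₂ v₁≢v₃ v₂≢v₃ (proj₂ (#fits-witness v₁ v₂ v₃ (v₄ ∷ []) fits₁))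
      root : ∀ {r} → 1 ≤ #fits₄ t₁ t₂ r →
             fourthPointQuadratic (area v₁ v₂ v₃) (area v₁ v₄ v₃) (area v₁ v₂ v₄) (t₂ -F t₁) (r -F t₁) ≡ 0F
      root fitsᵣ = fits⇒fourthPointQuadratic≡0 (proj₂ (#fits-witness v₁ v₂ v₃ (v₄ ∷ []) fitsᵣ))
      shift : ∀ {r r′} → r ≢ r′ → r -F t₁ ≢ r′ -F t₁
      shift r≢r′ = r≢r′ ∘ -F-cancelʳ {z = t₁}

    ∑#fits-over-t₃≤2 : ∀ t₁ t₂ → t₂ ≢ t₁ → ∑[ t₃ < p ] #fits₄ t₁ t₂ t₃ ≤ 2
    ∑#fits-over-t₃≤2 t₁ t₂ t₂≢t₁ with p ℕ.≟ 2
    ... | yes p≡2 = ≤-trans (∑≤* p (#fits≤1 v₁ v₂ v₃ (v₄ ∷ []) v₁≢v₂ v₁≢v₃ v₂≢v₃ t₁ t₂))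
                            (≤-reflexive (cong (_* 1) p≡2))
    ... | no  p≢2 = ∑≤2 p (#fits≤1 v₁ v₂ v₃ (v₄ ∷ []) v₁≢v₂ v₁≢v₃ v₂≢v₃ t₁ t₂) (no-three-t₃ p≢2 t₂≢t₁)

    countContaining-four : countContaining (v₁ ∷ v₂ ∷ v₃ ∷ v₄ ∷ []) ≤ p * ((p ∸ 1) * 2)
    countContaining-four = ≤-trans (countContaining≤∑#fits v₁ v₂ v₃ (v₄ ∷ []))
      (∑≤* p λ t₁ → ∑≤∸1* p t₁ (∑-zero p λ _ → #fits≡0 v₁ v₂ v₃ (v₄ ∷ []) λ { g (fits _ e₁ e₂ _ _) → v₁≢v₂ (trans (sym e₁) e₂) })
        (∑#fits-over-t₃≤2 t₁))

  length-AGL : length AGL ≡ ∑[ a < p ] ∑[ b < p ] ∑[ c < p ] ∑[ d < p ] ∑[ e < p ] ∑[ f < p ] 𝟙 (invertible? (aff a b c d e f))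
  length-AGL = trans (length-filter≡∑𝟙 invertible? allAff) (∑-allAff _)

  length-AGL≥ : (p ∸ 1) * (p * (p * ((p ∸ 1) * (p * (p * 1))))) ≤ length AGL
  length-AGL≥ = ≤-trans (∸1*≤∑ p λ a a′ small small′ → trans (≡0F-if-small small) (sym (≡0F-if-small small′)))
                        (≤-reflexive (sym length-AGL))
    where
    #invertible : F → F → F → F → ℕ
    #invertible a b c d = ∑[ e < p ] ∑[ f < p ] 𝟙 (invertible? (aff a b c d e f))

    singular-if-small : ∀ a b c d → #invertible a b c d < p * (p * 1) → a *F d ≡ b *F c
    singular-if-small a b c d small = -F≡0⇒≡ {a *F d} {b *F c} (¬invertible⇒det≡0 {aff a b c d 0F 0F} λ inv →
      <⇒≱ small (*≤∑ p λ e → *≤∑ p λ f → ≤-reflexive (sym (𝟙-yes (invertible? (aff a b c d e f)) inv))))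

    large-if-≢0 : ∀ {a} → a ≢ 0F → p * (p * ((p ∸ 1) * (p * (p * 1)))) ≤ ∑[ b < p ] ∑[ c < p ] ∑[ d < p ] #invertible a b c d
    large-if-≢0 {a} a≢0 = *≤∑ p λ b → *≤∑ p λ c → ∸1*≤∑ p λ d d′ small small′ →
      *F-cancelˡ a≢0 (trans (singular-if-small a b c d small) (sym (singular-if-small a b c d′ small′)))

    ≡0F-if-small : ∀ {a} → ∑[ b < p ] ∑[ c < p ] ∑[ d < p ] #invertible a b c d < p * (p * ((p ∸ 1) * (p * (p * 1))))
                   → a ≡ 0F
    ≡0F-if-small {a} small with a ≟ 0F
    ... | yes a≡0 = a≡0
    ... | no  a≢0 = ⊥-elim (<⇒≱ small (large-if-≢0 a≢0))

three-points-arithmetic : ∀ p q → p * (q * (q * 1)) * (p * (p * (p * 1))) ≡ q * (p * (p * (q * (p * (p * 1)))))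
three-points-arithmetic p q = ℕ-Solver.solve (p ∷ q ∷ [])

four-points-arithmetic : ∀ p → 2 ≤ p → p * ((p ∸ 1) * 2) * p ^ 4 ≤ 4 * ((p ∸ 1) * (p * (p * ((p ∸ 1) * (p * (p * 1))))))
four-points-arithmetic (suc zero) (s≤s ())
four-points-arithmetic (suc (suc r)) _ = ≤-trans (m≤m+n _ _) (≤-reflexive (identity r))
  where
  identity : ∀ r → (2 + r) * ((1 + r) * 2) * ((2 + r) * ((2 + r) * ((2 + r) * ((2 + r) * 1))))
                   + 2 * r * ((1 + r) * ((2 + r) * ((2 + r) * ((2 + r) * ((2 + r) * 1)))))
                   ≡ 4 * ((1 + r) * ((2 + r) * ((2 + r) * ((1 + r) * ((2 + r) * ((2 + r) * 1))))))
  identity r = ℕ-Solver.solve (r ∷ [])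

mainTheorem5 : (p : ℕ) → (pr : Prime p) →
    let open Fp p (prime⇒nonZero pr) in
    ((v₁ v₂ v₃ : Point) → v₁ ≢ v₂ → v₁ ≢ v₃ → v₂ ≢ v₃ →
      countContaining (v₁ ∷ v₂ ∷ v₃ ∷ []) * p ^ 3 ≤ length AGL)
    ×
    ((v₁ v₂ v₃ v₄ : Point) → v₁ ≢ v₂ → v₁ ≢ v₃ → v₁ ≢ v₄ → v₂ ≢ v₃ → v₂ ≢ v₄ → v₃ ≢ v₄ →
      countContaining (v₁ ∷ v₂ ∷ v₃ ∷ v₄ ∷ []) * p ^ 4 ≤ 4 * length AGL)
mainTheorem5 p pr =
  (λ v₁ v₂ v₃ v₁≢v₂ v₁≢v₃ v₂≢v₃ → begin
    countContaining (v₁ ∷ v₂ ∷ v₃ ∷ []) * p ^ 3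
      ≤⟨ *-monoˡ-≤ (p ^ 3) (countContaining-three v₁≢v₂ v₁≢v₃ v₂≢v₃) ⟩
    p * ((p ∸ 1) * ((p ∸ 1) * 1)) * p ^ 3
      ≡⟨ three-points-arithmetic p (p ∸ 1) ⟩
    (p ∸ 1) * (p * (p * ((p ∸ 1) * (p * (p * 1)))))
      ≤⟨ length-AGL≥ ⟩
    length AGL ∎) ,
  (λ v₁ v₂ v₃ v₄ v₁≢v₂ v₁≢v₃ v₁≢v₄ v₂≢v₃ v₂≢v₄ v₃≢v₄ → begin
    countContaining (v₁ ∷ v₂ ∷ v₃ ∷ v₄ ∷ []) * p ^ 4
      ≤⟨ *-monoˡ-≤ (p ^ 4) (countContaining-four v₁≢v₂ v₁≢v₃ v₁≢v₄ v₂≢v₃ v₂≢v₄ v₃≢v₄) ⟩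
    p * ((p ∸ 1) * 2) * p ^ 4
      ≤⟨ four-points-arithmetic p p≥2 ⟩
    4 * ((p ∸ 1) * (p * (p * ((p ∸ 1) * (p * (p * 1))))))
      ≤⟨ *-monoʳ-≤ 4 length-AGL≥ ⟩
    4 * length AGL ∎)
  where
  open PrimeField p pr using (countContaining; AGL; p≥2)
  open Counting p pr
  open ≤-Reasoning
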